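{- Let $P=(X,\leq)$ be a finite interval order and let $\lambda_1,\lambda_2$ be two admissible labellings of $P$. If $x,y\in X$ satisfy $\lambda_1(x)>\lambda_1(y)$ and $\lambda_2(x)<\lambda_2(y)$, then $x\sim y$.
   Context: A finite poset $P=(X,\leq)$ is an interval order if there is a map assigning to each $x\in X$ a closed real interval $[a_x,b_x]$ such that $x<y$ in $P$ iff $b_x<a_y$ (equivalently, $P$ has no induced subposet isomorphic to $2+2$). For $x\in X$ let $I(x)=\{z: z<x\}$ and $F(x)=\{z : z>x\}$ (strict). Write $x\sim y$ (order equivalent) if $I(x)=I(y)$ and $F(x)=F(y)$. A linear extension of $P$ is a bijection $\lambda:X\to\{1,\dots,|X|\}$ with $x<y\Rightarrow\lambda(x)<\lambda(y)$. A linear extension $\lambda$ is an admissible labelling if for all $x,y\in X$ with $\lambda(x)<\lambda(y)$, either $I(x)\subset I(y)$, or ($I(x)=I(y)$ and $F(x)\subset F(y)$), or $x\sim y$. -}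

module Defs where

open import Data.Nat using (ℕ)
open import Data.Fin using (Fin)
import Data.Fin as F
open import Data.Product using (_×_; Σ; _,_)
open import Data.Sum using (_⊎_)
open import Relation.Nullary using (¬_)
open import Data.Empty using (⊥)
open import Relation.Binary.PropositionalEquality using (_≡_; _≢_)
open import Relation.Binary.Structures using (IsPartialOrder)
open import Function.Definitions using (Injective)

record FinPoset (n : ℕ) : Set₁ where
  field
    _≤_ : Fin n → Fin n → Set
    isPartialOrder : IsPartialOrder _≡_ _≤_

module _ {n : ℕ} (P : FinPoset n) where
  open FinPoset P

  _<_ : Fin n → Fin n → Set
  x < y = x ≤ y × x ≢ y

  -- interval order: no induced 2+2, i.e. no a<b, c<d with a∥d-type crossings
  -- (a<b, c<d, a ≮ d, c ≮ b)
  IsIntervalOrder : Set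
  IsIntervalOrder = ∀ a b c d → a < b → c < d → ¬ a < d → ¬ c < b → ⊥

  Down Up : Fin n → Fin n → Set
  Down x z = z < x
  Up   x z = x < z

  _⊆_ : (Fin n → Set) → (Fin n → Set) → Set
  S ⊆ T = ∀ z → S z → T z

  _≐_ : (Fin n → Set) → (Fin n → Set) → Set
  S ≐ T = S ⊆ T × T ⊆ S

  _⊂_ : (Fin n → Set) → (Fin n → Set) → Set
  S ⊂ T = S ⊆ T × ¬ (T ⊆ S)

  _∼_ : Fin n → Fin n → Set
  x ∼ y = Down x ≐ Down y × Up x ≐ Up y

  -- linear extension: a bijection λ : X → {1..n} (here Fin n) preserving <
  IsLinearExtension : (Fin n → Fin n) → Set
  IsLinearExtension lab =
    Injective _≡_ _≡_ lab × (∀ x y → x < y → lab x F.< lab y)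

  IsAdmissibleLabelling : (Fin n → Fin n) → Set
  IsAdmissibleLabelling lab =
    IsLinearExtension lab ×
    (∀ x y → lab x F.< lab y →
       (Down x ⊂ Down y) ⊎ ((Down x ≐ Down y) × (Up x ⊂ Up y)) ⊎ (x ∼ y))

-- Admissibility orders elements lexicographically by (I(x), F(x)) under strict
-- inclusion, and this relation is asymmetric. So if λ₁ and λ₂ disagree on x and y,
-- neither labelling can place them by that relation, and the remaining case of the
-- definition is x ∼ y.
module Submission where

open import Defs
open import Data.Nat using (ℕ)
open import Data.Fin using (Fin)
import Data.Fin as F
open import Data.Empty using (⊥-elim)
open import Data.Product using (_×_; _,_; swap)
open import Data.Sum using (_⊎_; inj₁; inj₂; assocˡ)
open import Relation.Nullary using (¬_)

module _ {n : ℕ} (P : FinPoset n) where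

  LexicallyBelow : Fin n → Fin n → Set
  LexicallyBelow x y =
    _⊂_ P (Down P x) (Down P y) ⊎ (_≐_ P (Down P x) (Down P y) × _⊂_ P (Up P x) (Up P y))

  LexicallyBelow-asym : ∀ {x y} → LexicallyBelow x y → ¬ LexicallyBelow y x
  LexicallyBelow-asym (inj₁ (_ , y⊈x))       (inj₁ (y⊆x , _))         = y⊈x y⊆x
  LexicallyBelow-asym (inj₁ (_ , y⊈x))       (inj₂ ((y⊆x , _) , _))   = y⊈x y⊆x
  LexicallyBelow-asym (inj₂ ((y⊆x , _) , _)) (inj₁ (_ , y⊈x))         = y⊈x y⊆x
  LexicallyBelow-asym (inj₂ (_ , (_ , y⊈x))) (inj₂ (_ , (y⊆x , _)))   = y⊈x y⊆x

  ∼-sym : ∀ {x y} → _∼_ P x y → _∼_ P y x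
  ∼-sym (down≐ , up≐) = swap down≐ , swap up≐

  admissible⇒LexicallyBelow⊎∼ : ∀ {lab} → IsAdmissibleLabelling P lab →
    ∀ {x y} → lab x F.< lab y → LexicallyBelow x y ⊎ _∼_ P x y
  admissible⇒LexicallyBelow⊎∼ (_ , admissible) {x} {y} lab-x<y =
    assocˡ (admissible x y lab-x<y)

mainTheorem3 : {n : ℕ} (P : FinPoset n) → IsIntervalOrder P →
    (λ₁ λ₂ : Fin n → Fin n) →
    IsAdmissibleLabelling P λ₁ → IsAdmissibleLabelling P λ₂ →
    (x y : Fin n) → λ₁ y F.< λ₁ x → λ₂ x F.< λ₂ y →
    _∼_ P x y
mainTheorem3 P _ λ₁ λ₂ adm₁ adm₂ x y λ₁y<λ₁x λ₂x<λ₂y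
  with admissible⇒LexicallyBelow⊎∼ P adm₁ λ₁y<λ₁x
     | admissible⇒LexicallyBelow⊎∼ P adm₂ λ₂x<λ₂y
... | inj₂ y∼x | _        = ∼-sym P y∼x
... | inj₁ _   | inj₂ x∼y = x∼y
... | inj₁ y⊏x | inj₁ x⊏y = ⊥-elim (LexicallyBelow-asym P x⊏y y⊏x)
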